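{- For $n\geqslant1$ let $\widehat{P}_n(x)=\sum_{\pi\in\mathfrak{S}_n}x^{\mathrm{lpk}(\pi)}$ be the left peak polynomial. Then for every $n\geqslant1$, $$\widehat{P}_{2n}(x)=\sum_{j=0}^{n}(2j)!\,V(n,j)\,x^j(1-x)^{n-j},\qquad \widehat{P}_{2n+1}(x)=\sum_{j=0}^{n}(2j+1)!\,V(n,j)\,x^j(1-x)^{n-j}.$$
   Context: $\mathfrak{S}_n$ is the symmetric group on $[n]$. For $\pi=\pi(1)\cdots\pi(n)\in\mathfrak{S}_n$, with the convention $\pi(0)=0$, a left peak is an index $i\in[n-1]$ with $\pi(i-1)<\pi(i)>\pi(i+1)$, and $\mathrm{lpk}(\pi)$ is the number of left peaks. The central factorial numbers of odd indices $V(n,k)$ ($n,k\geqslant0$) are defined by $V(0,0)=1$, $V(0,k)=0$ for $k\neq0$, and $V(n,k)=V(n-1,k-1)+(2k+1)^2V(n-1,k)$ (with $V(n,-1)=0$); equivalently $V(n,k)=4^{n-k}T(2n+1,2k+1)$ where $T$ are Riordan's central factorial numbers of the second kind. -}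

module Defs where

open import Data.Bool using (Bool; true; false; _∧_; not)
open import Data.Nat as ℕ using (ℕ; zero; suc; _<ᵇ_; _≡ᵇ_; _!)
open import Data.List using (List; []; _∷_; map; concatMap; filterᵇ; upTo; foldr)
open import Data.Bool.ListAction using (any)
open import Data.Integer as ℤ using (ℤ; +_)

words : ℕ → ℕ → List (List ℕ)
words n zero    = [] ∷ []
words n (suc k) = concatMap (λ a → map (a ∷_) (words n k)) (map suc (upTo n))

distinct : List ℕ → Bool
distinct []       = true
distinct (a ∷ w)  = not (any (a ≡ᵇ_) w) ∧ distinct w

perms : ℕ → List (List ℕ)
perms n = filterᵇ distinct (words n n)

peaks : List ℕ → ℕ
peaks (a ∷ b ∷ c ∷ w) = (if (a <ᵇ b) ∧ (c <ᵇ b) then 1 else 0) ℕ.+ peaks (b ∷ c ∷ w)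
  where open import Data.Bool using (if_then_else_)
peaks _ = 0

-- left peaks: convention π(0) = 0, indices i ∈ [n-1]
lpk : List ℕ → ℕ
lpk π = peaks (0 ∷ π)

sumℤ : List ℤ → ℤ
sumℤ = foldr ℤ._+_ (+ 0)

leftPeakPoly : ℕ → ℤ → ℤ
leftPeakPoly n x = sumℤ (map (λ π → x ℤ.^ lpk π) (perms n))

V : ℕ → ℕ → ℕ
V zero    zero    = 1
V zero    (suc k) = 0
V (suc n) zero    = V n zero
V (suc n) (suc k) = V n k ℕ.+ (2 ℕ.* suc k ℕ.+ 1) ℕ.^ 2 ℕ.* V n (suc k)

rhs : (ℕ → ℕ) → ℕ → ℤ → ℤ
rhs c n x = sumℤ (map (λ j → + (c j ℕ.* V n j) ℤ.* (x ℤ.^ j) ℤ.* ((+ 1 ℤ.- x) ℤ.^ (n ℕ.∸ j))) (upTo (suc n)))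

module Submission where

-- Work with coefficient sequences (ℕ → ℤ) and let A_N be that of P̂_N. Inserting N + 1 into
-- the N + 1 slots of a permutation of [N] with t left peaks gives 2t + 1 permutations with t
-- left peaks and N − 2t with t + 1, so A_{N+1} = L_N A_N for the operator
-- L_N p = (1 + N x) p + 2x(1 − x) p′. The polynomials x^j (1 − x)^m are eigenvectors:
-- L_{2(j+m)} (x^j (1 − x)^m) = (2j + 1) x^j (1 − x)^m. Hence L_{2d} turns the even closed form
-- of order d into the odd one, and L_{2d+1} = L_{2d} + x turns the odd one into the even one of
-- order d + 1 once x^j (1 − x)^{d−j} is split as x^j (1 − x)^{d+1−j} + x^{j+1} (1 − x)^{d−j}
-- and the coefficients are collected with the recurrence of V.

open import Function using (_∘_; _⟨_⟩_; Equivalence; _⇔_; mk⇔)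
open import Data.Bool using (true; false; T; _∧_; if_then_else_)
import Data.Bool.Properties as BoolP
open import Data.Sum using (_⊎_; inj₁; inj₂)
open import Relation.Nullary using (¬_; ¬?; yes; no; contradiction)
open import Relation.Nullary.Decidable using (T?)
open import Data.Nat as ℕ using (ℕ; zero; suc; _∸_; _!; _<_; _≤_; z≤n; s≤s; _<ᵇ_; _≡ᵇ_; _≟_)
import Data.Nat.Properties as ℕP
import Data.Nat.Tactic.RingSolver as NS
open import Data.Integer using (ℤ; +_; 0ℤ; 1ℤ; _+_; _-_; _*_; _^_)
import Data.Integer.Properties as ℤP
open import Data.Integer.Tactic.RingSolver using (solve-∀)
open import Data.Product using (_×_; _,_; proj₁; proj₂)
open import Data.List using (List; []; _∷_; _++_; map; length; applyUpTo; upTo; concatMap; filter)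
import Data.List.Properties as LP
open import Data.Bool.ListAction using (any)
open import Data.List.Membership.Propositional using (_∈_; _∉_; find; lose)
open import Data.List.Membership.Propositional.Properties.WithK using (unique∧set⇒bag)
open import Data.List.Membership.DecPropositional ℕ._≟_ using (_∈?_)
open import Data.List.Membership.Propositional.Properties
  using (∈-map⁺; ∈-map⁻; ∈-upTo⁺; ∈-upTo⁻; ∈-concatMap⁺; ∈-concatMap⁻; ∈-filter⁺; ∈-filter⁻)
open import Data.List.Relation.Unary.All as All using (All; []; _∷_)
import Data.List.Relation.Unary.All.Properties as AllP
open AllP using (¬Any⇒All¬; All¬⇒¬Any)
open import Data.List.Relation.Unary.Any as Any using (here; there)
import Data.List.Relation.Unary.Any.Properties as AnyP
open import Data.List.Relation.Unary.Unique.Propositional using (Unique)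
open import Data.List.Relation.Unary.AllPairs using ([]; _∷_)
import Data.List.Relation.Unary.Unique.Propositional.Properties as UniqueP
open import Data.List.Relation.Binary.Permutation.Propositional
  using (_↭_; prep; swap; ↭-sym; ↭⇒↭ₛ) renaming (refl to ↭-refl; trans to ↭-trans)
import Data.List.Relation.Binary.Permutation.Propositional.Properties as PermP
open PermP using (↭-length; All-resp-↭)
import Data.List.Relation.Binary.Permutation.Setoid.Properties as PermₛP
open import Data.List.Relation.Binary.BagAndSetEquality using (∼bag⇒↭)
open import Relation.Binary.PropositionalEquality

open import Defs

-- Coefficient sequences

Seq : Set
Seq = ℕ → ℤ

infixl 6 _⊕_ _⊖_
infixl 7 _⊛_

_⊕_ _⊖_ : Seq → Seq → Seq
(p ⊕ q) k = p k + q k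
(p ⊖ q) k = p k - q k

_⊛_ : ℤ → Seq → Seq
(a ⊛ p) k = a * p k

𝟘 : Seq
𝟘 _ = 0ℤ

sumTo : ℕ → (ℕ → ℤ) → ℤ
sumTo zero    f = 0ℤ
sumTo (suc n) f = f 0 + sumTo n (f ∘ suc)

Σ⟨_⟩ : ℕ → (ℕ → Seq) → Seq
Σ⟨ n ⟩ F k = sumTo n (λ j → F j k)

shift : Seq → Seq
shift p zero    = 0ℤ
shift p (suc k) = p k

shiftBy : ℕ → Seq → Seq
shiftBy zero    p = p
shiftBy (suc j) p = shift (shiftBy j p)

mono : ℕ → Seq
mono v = shiftBy v unit
  where
  unit : Seq
  unit zero    = 1ℤ
  unit (suc k) = 0ℤ

powOneMinusX : ℕ → Seq
powOneMinusX zero    = mono 0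
powOneMinusX (suc m) = powOneMinusX m ⊖ shift (powOneMinusX m)

-- x^j (1 − x)^m, a Bernstein polynomial without its binomial coefficient.
bernstein : ℕ → ℕ → Seq
bernstein j m = shiftBy j (powOneMinusX m)

shift-cong : ∀ {p q} → p ≗ q → shift p ≗ shift q
shift-cong p≗q zero    = refl
shift-cong p≗q (suc k) = p≗q k

shift-⊕ : ∀ p q → shift (p ⊕ q) ≗ shift p ⊕ shift q
shift-⊕ p q zero    = refl
shift-⊕ p q (suc k) = refl

shift-⊖ : ∀ p q → shift (p ⊖ q) ≗ shift p ⊖ shift q
shift-⊖ p q zero    = refl
shift-⊖ p q (suc k) = refl

shift-⊛ : ∀ a p → shift (a ⊛ p) ≗ a ⊛ shift p
shift-⊛ a p zero    = sym (ℤP.*-zeroʳ a)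
shift-⊛ a p (suc k) = refl

shiftBy-cong : ∀ j {p q} → p ≗ q → shiftBy j p ≗ shiftBy j q
shiftBy-cong zero    p≗q = p≗q
shiftBy-cong (suc j) p≗q = shift-cong (shiftBy-cong j p≗q)

shiftBy-⊖ : ∀ j p q → shiftBy j (p ⊖ q) ≗ shiftBy j p ⊖ shiftBy j q
shiftBy-⊖ zero    p q k = refl
shiftBy-⊖ (suc j) p q k = trans (shift-cong (shiftBy-⊖ j p q) k) (shift-⊖ _ _ k)

shiftBy-shift : ∀ j p → shiftBy j (shift p) ≗ shift (shiftBy j p)
shiftBy-shift zero    p k = refl
shiftBy-shift (suc j) p k = shift-cong (shiftBy-shift j p) k

bernstein-split : ∀ {j d} → j ≤ d → bernstein j (suc d ∸ j) ≗ bernstein j (d ∸ j) ⊖ shift (bernstein j (d ∸ j))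
bernstein-split {j} {d} j≤d k = begin
  shiftBy j (powOneMinusX (suc d ∸ j)) k            ≡⟨ cong (λ m → shiftBy j (powOneMinusX m) k) (ℕP.+-∸-assoc 1 j≤d) ⟩
  shiftBy j (e ⊖ shift e) k                         ≡⟨ shiftBy-⊖ j e (shift e) k ⟩
  shiftBy j e k - shiftBy j (shift e) k             ≡⟨ cong (shiftBy j e k -_) (shiftBy-shift j e k) ⟩
  shiftBy j e k - shift (shiftBy j e) k             ∎
  where
  open ≡-Reasoning
  e = powOneMinusX (d ∸ j)

sumTo-cong< : ∀ n {f g : ℕ → ℤ} → (∀ j → j < n → f j ≡ g j) → sumTo n f ≡ sumTo n g
sumTo-cong< zero    f≡g = refl
sumTo-cong< (suc n) f≡g = cong₂ _+_ (f≡g 0 (s≤s z≤n)) (sumTo-cong< n (λ j j<n → f≡g (suc j) (s≤s j<n)))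

sumTo-+ : ∀ n (f g : ℕ → ℤ) → sumTo n (λ j → f j + g j) ≡ sumTo n f + sumTo n g
sumTo-+ zero    f g = refl
sumTo-+ (suc n) f g = trans (cong (λ s → (f 0 + g 0) + s) (sumTo-+ n (f ∘ suc) (g ∘ suc)))
                            (interchange (f 0) (g 0) (sumTo n (f ∘ suc)) (sumTo n (g ∘ suc)))
  where
  interchange : ∀ a b c d → (a + b) + (c + d) ≡ (a + c) + (b + d)
  interchange = solve-∀

sumTo-last : ∀ n (f : ℕ → ℤ) → sumTo (suc n) f ≡ sumTo n f + f n
sumTo-last zero    f = trans (ℤP.+-identityʳ (f 0)) (sym (ℤP.+-identityˡ (f 0)))
sumTo-last (suc n) f = trans (cong (λ s → f 0 + s) (sumTo-last n (f ∘ suc))) (sym (ℤP.+-assoc (f 0) _ _))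

sumTo-reindex : ∀ n (f g : ℕ → ℤ) → f n ≡ 0ℤ → g 0 ≡ 0ℤ →
                sumTo (suc n) (λ j → f j + g j) ≡ sumTo n (λ j → f j + g (suc j))
sumTo-reindex n f g fn≡0 g0≡0 = begin
  sumTo (suc n) (λ j → f j + g j)                  ≡⟨ sumTo-+ (suc n) f g ⟩
  sumTo (suc n) f + (g 0 + sumTo n (g ∘ suc))      ≡⟨ cong₂ (λ u v → u + (v + sumTo n (g ∘ suc)))
                                                            (trans (sumTo-last n f) (cong (λ v → sumTo n f + v) fn≡0)) g0≡0 ⟩
  (sumTo n f + 0ℤ) + (0ℤ + sumTo n (g ∘ suc))      ≡⟨ cong₂ _+_ (ℤP.+-identityʳ (sumTo n f)) (ℤP.+-identityˡ (sumTo n (g ∘ suc))) ⟩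
  sumTo n f + sumTo n (g ∘ suc)                    ≡⟨ sumTo-+ n f (g ∘ suc) ⟨
  sumTo n (λ j → f j + g (suc j))                  ∎
  where open ≡-Reasoning

Σ-cong< : ∀ n {F G : ℕ → Seq} → (∀ j → j < n → F j ≗ G j) → Σ⟨ n ⟩ F ≗ Σ⟨ n ⟩ G
Σ-cong< n F≗G k = sumTo-cong< n (λ j j<n → F≗G j j<n k)

-- The left peak operator

-- L_N p = (1 + N x) p + 2x(1 − x) p′, on coefficients.
peakOp : ℕ → Seq → Seq
peakOp N p k = (+ 2 * + k + 1ℤ) * p k + (+ N + + 2 - + 2 * + k) * shift p k

peakOp-cong : ∀ N {p q} → p ≗ q → peakOp N p ≗ peakOp N q
peakOp-cong N p≗q k = cong₂ (λ u v → (+ 2 * + k + 1ℤ) * u + (+ N + + 2 - + 2 * + k) * v)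
                            (p≗q k) (shift-cong p≗q k)

peakOp-⊕ : ∀ N p q → peakOp N (p ⊕ q) ≗ peakOp N p ⊕ peakOp N q
peakOp-⊕ N p q k = cong (λ s → α * (p k + q k) + β * s) (shift-⊕ p q k)
                 ⟨ trans ⟩ distrib α β (p k) (q k) (shift p k) (shift q k)
  where
  α = + 2 * + k + 1ℤ
  β = + N + + 2 - + 2 * + k
  distrib : ∀ α β x y u v → α * (x + y) + β * (u + v) ≡ (α * x + β * u) + (α * y + β * v)
  distrib = solve-∀

peakOp-⊖ : ∀ N p q → peakOp N (p ⊖ q) ≗ peakOp N p ⊖ peakOp N q
peakOp-⊖ N p q k = cong (λ s → α * (p k - q k) + β * s) (shift-⊖ p q k)
                 ⟨ trans ⟩ distrib α β (p k) (q k) (shift p k) (shift q k)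
  where
  α = + 2 * + k + 1ℤ
  β = + N + + 2 - + 2 * + k
  distrib : ∀ α β x y u v → α * (x - y) + β * (u - v) ≡ (α * x + β * u) - (α * y + β * v)
  distrib = solve-∀

peakOp-⊛ : ∀ N a p → peakOp N (a ⊛ p) ≗ a ⊛ peakOp N p
peakOp-⊛ N a p k = cong (λ s → α * (a * p k) + β * s) (shift-⊛ a p k)
                 ⟨ trans ⟩ distrib α β a (p k) (shift p k)
  where
  α = + 2 * + k + 1ℤ
  β = + N + + 2 - + 2 * + k
  distrib : ∀ α β a x u → α * (a * x) + β * (a * u) ≡ a * (α * x + β * u)
  distrib = solve-∀

peakOp-𝟘 : ∀ N → peakOp N 𝟘 ≗ 𝟘
peakOp-𝟘 N zero    = annihilate (+ 1) (+ N + + 2 - + 0)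
  where
  annihilate : ∀ α β → α * 0ℤ + β * 0ℤ ≡ 0ℤ
  annihilate = solve-∀
peakOp-𝟘 N (suc k) = annihilate (+ 2 * + suc k + 1ℤ) (+ N + + 2 - + 2 * + suc k)
  where
  annihilate : ∀ α β → α * 0ℤ + β * 0ℤ ≡ 0ℤ
  annihilate = solve-∀

peakOp-Σ : ∀ N n F → peakOp N (Σ⟨ n ⟩ F) ≗ Σ⟨ n ⟩ (peakOp N ∘ F)
peakOp-Σ N zero    F = peakOp-𝟘 N
peakOp-Σ N (suc n) F k =
  peakOp-⊕ N (F 0) (Σ⟨ n ⟩ (F ∘ suc)) k ⟨ trans ⟩ cong (λ s → peakOp N (F 0) k + s) (peakOp-Σ N n (F ∘ suc) k)

peakOp-suc : ∀ N p → peakOp (suc N) p ≗ peakOp N p ⊕ shift p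
peakOp-suc N p k = regroup (+ 2 * + k + 1ℤ) (+ N) (+ k) (p k) (shift p k)
  where
  regroup : ∀ α n k x s → α * x + ((1ℤ + n) + + 2 - + 2 * k) * s ≡ (α * x + (n + + 2 - + 2 * k) * s) + s
  regroup = solve-∀

peakOp-shift : ∀ N q → peakOp (2 ℕ.+ N) (shift q) ≗ shift (peakOp N q) ⊕ + 2 ⊛ shift q
peakOp-shift N q zero    = regroup (+ 2 * + 0 + 1ℤ) (+ 2 + + N + + 2 - + 2 * + 0)
  where
  regroup : ∀ α β → α * 0ℤ + β * 0ℤ ≡ 0ℤ + + 2 * 0ℤ
  regroup = solve-∀
peakOp-shift N q (suc k) = regroup (+ N) (+ k) (q k) (shift q k)
  where
  regroup : ∀ n k x s → (+ 2 * (1ℤ + k) + 1ℤ) * x + ((+ 2 + n) + + 2 - + 2 * (1ℤ + k)) * s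
                        ≡ ((+ 2 * k + 1ℤ) * x + (n + + 2 - + 2 * k) * s) + + 2 * x
  regroup = solve-∀

peakOp-+2 : ∀ N p → peakOp (2 ℕ.+ N) p ≗ peakOp N p ⊕ + 2 ⊛ shift p
peakOp-+2 N p k = regroup (+ 2 * + k + 1ℤ) (+ N) (+ k) (p k) (shift p k)
  where
  regroup : ∀ α n k x s → α * x + ((+ 2 + n) + + 2 - + 2 * k) * s ≡ (α * x + (n + + 2 - + 2 * k) * s) + + 2 * s
  regroup = solve-∀

peakOp-powOneMinusX : ∀ m → peakOp (2 ℕ.* m) (powOneMinusX m) ≗ powOneMinusX m
peakOp-powOneMinusX zero zero          = refl
peakOp-powOneMinusX zero (suc zero)    = refl
peakOp-powOneMinusX zero (suc (suc k)) = annihilate (+ 2 * + suc (suc k) + 1ℤ) (+ 0 + + 2 - + 2 * + suc (suc k))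
  where
  annihilate : ∀ α β → α * 0ℤ + β * 0ℤ ≡ 0ℤ
  annihilate = solve-∀
peakOp-powOneMinusX (suc m) k = begin
  peakOp (2 ℕ.* suc m) (e ⊖ shift e) k                    ≡⟨ cong (λ N → peakOp N (e ⊖ shift e) k) (ℕP.*-suc 2 m) ⟩
  peakOp (2 ℕ.+ 2 ℕ.* m) (e ⊖ shift e) k                  ≡⟨ peakOp-⊖ (2 ℕ.+ 2 ℕ.* m) e (shift e) k ⟩
  peakOp (2 ℕ.+ 2 ℕ.* m) e k - peakOp (2 ℕ.+ 2 ℕ.* m) (shift e) k
    ≡⟨ cong₂ _-_ (peakOp-+2 (2 ℕ.* m) e k) (peakOp-shift (2 ℕ.* m) e k) ⟩
  (peakOp (2 ℕ.* m) e k + + 2 * shift e k) - (shift (peakOp (2 ℕ.* m) e) k + + 2 * shift e k)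
    ≡⟨ cong₂ (λ u v → (u + + 2 * shift e k) - (v + + 2 * shift e k))
             (peakOp-powOneMinusX m k) (shift-cong (peakOp-powOneMinusX m) k) ⟩
  (e k + + 2 * shift e k) - (shift e k + + 2 * shift e k) ≡⟨ cancel (e k) (shift e k) ⟩
  e k - shift e k                                          ∎
  where
  open ≡-Reasoning
  e = powOneMinusX m
  cancel : ∀ x s → (x + + 2 * s) - (s + + 2 * s) ≡ x - s
  cancel = solve-∀

peakOp-bernstein : ∀ j m → peakOp (2 ℕ.* (j ℕ.+ m)) (bernstein j m) ≗ (+ 2 * + j + 1ℤ) ⊛ bernstein j m
peakOp-bernstein zero    m k = trans (peakOp-powOneMinusX m k) (sym (ℤP.*-identityˡ _))
peakOp-bernstein (suc j) m k = begin
  peakOp (2 ℕ.* suc (j ℕ.+ m)) (shift b) k               ≡⟨ cong (λ N → peakOp N (shift b) k) (ℕP.*-suc 2 (j ℕ.+ m)) ⟩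
  peakOp (2 ℕ.+ 2 ℕ.* (j ℕ.+ m)) (shift b) k             ≡⟨ peakOp-shift (2 ℕ.* (j ℕ.+ m)) b k ⟩
  shift (peakOp (2 ℕ.* (j ℕ.+ m)) b) k + + 2 * shift b k
    ≡⟨ cong (λ s → s + + 2 * shift b k)
            (trans (shift-cong (peakOp-bernstein j m) k) (shift-⊛ (+ 2 * + j + 1ℤ) b k)) ⟩
  (+ 2 * + j + 1ℤ) * shift b k + + 2 * shift b k          ≡⟨ collect (+ j) (shift b k) ⟩
  (+ 2 * + suc j + 1ℤ) * shift b k                        ∎
  where
  open ≡-Reasoning
  b = bernstein j m
  collect : ∀ j s → (+ 2 * j + 1ℤ) * s + + 2 * s ≡ (+ 2 * (1ℤ + j) + 1ℤ) * s
  collect = solve-∀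

peakOp-bernstein-≤ : ∀ {j d} → j ≤ d → peakOp (2 ℕ.* d) (bernstein j (d ∸ j)) ≗ (+ 2 * + j + 1ℤ) ⊛ bernstein j (d ∸ j)
peakOp-bernstein-≤ {j} {d} j≤d k =
  cong (λ m → peakOp (2 ℕ.* m) (bernstein j (d ∸ j)) k) (sym (ℕP.m+[n∸m]≡n j≤d)) ⟨ trans ⟩ peakOp-bernstein j (d ∸ j) k

peakOp-suc-bernstein : ∀ {j d} → j ≤ d → peakOp (suc (2 ℕ.* d)) (bernstein j (d ∸ j))
                       ≗ (+ 2 * + j + 1ℤ) ⊛ bernstein j (suc d ∸ j) ⊕ + 2 * + suc j ⊛ shift (bernstein j (d ∸ j))
peakOp-suc-bernstein {j} {d} j≤d k = begin
  peakOp (suc (2 ℕ.* d)) b k                                      ≡⟨ peakOp-suc (2 ℕ.* d) b k ⟩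
  peakOp (2 ℕ.* d) b k + shift b k                                ≡⟨ cong (_+ shift b k) (peakOp-bernstein-≤ j≤d k) ⟩
  (+ 2 * + j + 1ℤ) * b k + shift b k                              ≡⟨ regroup (+ j) (b k) (shift b k) ⟩
  (+ 2 * + j + 1ℤ) * (b k - shift b k) + + 2 * + suc j * shift b k
    ≡⟨ cong (λ v → (+ 2 * + j + 1ℤ) * v + + 2 * + suc j * shift b k) (bernstein-split j≤d k) ⟨
  (+ 2 * + j + 1ℤ) * bernstein j (suc d ∸ j) k + + 2 * + suc j * shift b k ∎
  where
  open ≡-Reasoning
  b = bernstein j (d ∸ j)
  regroup : ∀ y x s → (+ 2 * y + 1ℤ) * x + s ≡ (+ 2 * y + 1ℤ) * (x - s) + + 2 * (1ℤ + y) * s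
  regroup = solve-∀

rhsTerm : (ℕ → ℕ) → ℕ → ℕ → Seq
rhsTerm c d j = + (c j ℕ.* V d j) ⊛ bernstein j (d ∸ j)

rhsSeq : (ℕ → ℕ) → ℕ → Seq
rhsSeq c d = Σ⟨ suc d ⟩ (rhsTerm c d)

evenFact oddFact : ℕ → ℕ
evenFact j = (2 ℕ.* j) !
oddFact  j = suc (2 ℕ.* j) !

pos-suc-double : ∀ j → + suc (2 ℕ.* j) ≡ + 2 * + j + 1ℤ
pos-suc-double j = trans (cong (λ n → 1ℤ + n) (ℤP.pos-* 2 j)) (ℤP.+-comm 1ℤ (+ 2 * + j))

V-above : ∀ d j → d < j → V d j ≡ 0
V-above zero    (suc j) _         = refl
V-above (suc d) (suc j) (s≤s d<j) =
  cong₂ (λ u v → u ℕ.+ (2 ℕ.* suc j ℕ.+ 1) ℕ.^ 2 ℕ.* v) (V-above d j d<j) (V-above d (suc j) (ℕP.m<n⇒m<1+n d<j))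
  ⟨ trans ⟩ ℕP.*-zeroʳ ((2 ℕ.* suc j ℕ.+ 1) ℕ.^ 2)

oddFact-coeff : ∀ j v → + (oddFact j ℕ.* v) ≡ (+ 2 * + j + 1ℤ) * + (evenFact j ℕ.* v)
oddFact-coeff j v = begin
  + (suc (2 ℕ.* j) ℕ.* evenFact j ℕ.* v)     ≡⟨ cong +_ (ℕP.*-assoc (suc (2 ℕ.* j)) (evenFact j) v) ⟩
  + (suc (2 ℕ.* j) ℕ.* (evenFact j ℕ.* v))   ≡⟨ ℤP.pos-* (suc (2 ℕ.* j)) (evenFact j ℕ.* v) ⟩
  + suc (2 ℕ.* j) * + (evenFact j ℕ.* v)     ≡⟨ cong (_* + (evenFact j ℕ.* v)) (pos-suc-double j) ⟩
  (+ 2 * + j + 1ℤ) * + (evenFact j ℕ.* v)    ∎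
  where open ≡-Reasoning

V-evenFact-suc : ∀ d j → evenFact (suc j) ℕ.* V (suc d) (suc j)
                         ≡ suc (2 ℕ.* suc j) ℕ.* (oddFact (suc j) ℕ.* V d (suc j))
                           ℕ.+ 2 ℕ.* suc j ℕ.* (oddFact j ℕ.* V d j)
V-evenFact-suc d j = unfold (ℕP.*-suc 2 j)
  where
  expand : ∀ y e a b → suc (suc y) ℕ.* (suc y ℕ.* e) ℕ.* (a ℕ.+ (suc (suc y) ℕ.+ 1) ℕ.* ((suc (suc y) ℕ.+ 1) ℕ.* 1) ℕ.* b)
                       ≡ suc (suc (suc y)) ℕ.* (suc (suc (suc y)) ℕ.* (suc (suc y) ℕ.* (suc y ℕ.* e)) ℕ.* b)
                         ℕ.+ suc (suc y) ℕ.* (suc y ℕ.* e ℕ.* a)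
  expand = NS.solve-∀
  unfold : ∀ {n} → n ≡ 2 ℕ.+ 2 ℕ.* j →
           n ! ℕ.* (V d j ℕ.+ (n ℕ.+ 1) ℕ.^ 2 ℕ.* V d (suc j))
           ≡ suc n ℕ.* (suc n ! ℕ.* V d (suc j)) ℕ.+ n ℕ.* (oddFact j ℕ.* V d j)
  unfold refl = expand (2 ℕ.* j) ((2 ℕ.* j) !) (V d j) (V d (suc j))

peakOp-rhsTerm-even : ∀ {j d} → j ≤ d → peakOp (2 ℕ.* d) (rhsTerm evenFact d j) ≗ rhsTerm oddFact d j
peakOp-rhsTerm-even {j} {d} j≤d k = begin
  peakOp (2 ℕ.* d) (+ a ⊛ b) k                     ≡⟨ peakOp-⊛ (2 ℕ.* d) (+ a) b k ⟩
  + a * peakOp (2 ℕ.* d) b k                       ≡⟨ cong (+ a *_) (peakOp-bernstein-≤ j≤d k) ⟩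
  + a * ((+ 2 * + j + 1ℤ) * b k)                   ≡⟨ reassociate (+ a) (+ 2 * + j + 1ℤ) (b k) ⟩
  (+ 2 * + j + 1ℤ) * + a * b k                     ≡⟨ cong (_* b k) (oddFact-coeff j (V d j)) ⟨
  + (oddFact j ℕ.* V d j) * b k                    ∎
  where
  open ≡-Reasoning
  a = evenFact j ℕ.* V d j
  b = bernstein j (d ∸ j)
  reassociate : ∀ a c x → a * (c * x) ≡ c * a * x
  reassociate = solve-∀

peakOp-rhsTerm-odd : ∀ {j d} → j ≤ d → let a = oddFact j ℕ.* V d j in
                     peakOp (suc (2 ℕ.* d)) (rhsTerm oddFact d j)
                     ≗ + (suc (2 ℕ.* j) ℕ.* a) ⊛ bernstein j (suc d ∸ j) ⊕ + (2 ℕ.* suc j ℕ.* a) ⊛ shift (bernstein j (d ∸ j))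
peakOp-rhsTerm-odd {j} {d} j≤d k = begin
  peakOp (suc (2 ℕ.* d)) (+ a ⊛ b) k                   ≡⟨ peakOp-⊛ (suc (2 ℕ.* d)) (+ a) b k ⟩
  + a * peakOp (suc (2 ℕ.* d)) b k                     ≡⟨ cong (+ a *_) (peakOp-suc-bernstein j≤d k) ⟩
  + a * ((+ 2 * + j + 1ℤ) * b′ k + + 2 * + suc j * shift b k)
    ≡⟨ distribute (+ a) (+ 2 * + j + 1ℤ) (+ 2 * + suc j) (b′ k) (shift b k) ⟩
  (+ 2 * + j + 1ℤ) * + a * b′ k + + 2 * + suc j * + a * shift b k
    ≡⟨ cong₂ (λ u v → u * + a * b′ k + v * + a * shift b k) (pos-suc-double j) (ℤP.pos-* 2 (suc j)) ⟨
  + suc (2 ℕ.* j) * + a * b′ k + + (2 ℕ.* suc j) * + a * shift b k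
    ≡⟨ cong₂ (λ u v → u * b′ k + v * shift b k) (ℤP.pos-* (suc (2 ℕ.* j)) a) (ℤP.pos-* (2 ℕ.* suc j) a) ⟨
  + (suc (2 ℕ.* j) ℕ.* a) * b′ k + + (2 ℕ.* suc j ℕ.* a) * shift b k ∎
  where
  open ≡-Reasoning
  a = oddFact j ℕ.* V d j
  b = bernstein j (d ∸ j)
  b′ = bernstein j (suc d ∸ j)
  distribute : ∀ a c e x s → a * (c * x + e * s) ≡ c * a * x + e * a * s
  distribute = solve-∀

peakOp-rhsSeq-even : ∀ d → peakOp (2 ℕ.* d) (rhsSeq evenFact d) ≗ rhsSeq oddFact d
peakOp-rhsSeq-even d k =
  peakOp-Σ (2 ℕ.* d) (suc d) (rhsTerm evenFact d) k ⟨ trans ⟩ Σ-cong< (suc d) (λ j j<1+d → peakOp-rhsTerm-even (ℕP.≤-pred j<1+d)) k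

peakOp-rhsSeq-odd : ∀ d → peakOp (suc (2 ℕ.* d)) (rhsSeq oddFact d) ≗ rhsSeq evenFact (suc d)
peakOp-rhsSeq-odd d k = begin
  peakOp (suc (2 ℕ.* d)) (rhsSeq oddFact d) k         ≡⟨ peakOp-Σ (suc (2 ℕ.* d)) (suc d) (rhsTerm oddFact d) k ⟩
  sumTo (suc d) (λ j → peakOp (suc (2 ℕ.* d)) (rhsTerm oddFact d j) k)
    ≡⟨ sumTo-cong< (suc d) (λ j j<1+d → peakOp-rhsTerm-odd (ℕP.≤-pred j<1+d) k) ⟩
  sumTo (suc d) (λ j → U j k + W (suc j) k)           ≡⟨ sumTo-reindex (suc d) (λ j → U j k) (λ j → W j k) U-top refl ⟨
  sumTo (suc (suc d)) (λ j → U j k + W j k)           ≡⟨ sumTo-cong< (suc (suc d)) (λ j _ → collect j) ⟩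
  rhsSeq evenFact (suc d) k                           ∎
  where
  open ≡-Reasoning
  a : ℕ → ℕ
  a j = oddFact j ℕ.* V d j
  b′ : ℕ → Seq
  b′ j = bernstein j (suc d ∸ j)
  lower : ℕ → ℕ
  lower zero    = 0
  lower (suc j) = 2 ℕ.* suc j ℕ.* a j
  U W : ℕ → Seq
  U j = + (suc (2 ℕ.* j) ℕ.* a j) ⊛ b′ j
  W j = + lower j ⊛ b′ j
  U-top : U (suc d) k ≡ 0ℤ
  U-top = cong (λ n → + (suc (2 ℕ.* suc d) ℕ.* n) * b′ (suc d) k)
               (trans (cong (oddFact (suc d) ℕ.*_) (V-above d (suc d) (ℕP.n<1+n d))) (ℕP.*-zeroʳ (oddFact (suc d))))
          ⟨ trans ⟩ cong (λ n → + n * b′ (suc d) k) (ℕP.*-zeroʳ (suc (2 ℕ.* suc d)))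
  coefficient : ∀ j → evenFact j ℕ.* V (suc d) j ≡ suc (2 ℕ.* j) ℕ.* a j ℕ.+ lower j
  coefficient zero    = unit (V d 0)
    where
    unit : ∀ v → 1 ℕ.* v ≡ 1 ℕ.* (1 ℕ.* v) ℕ.+ 0
    unit = NS.solve-∀
  coefficient (suc j) = V-evenFact-suc d j
  collect : ∀ j → U j k + W j k ≡ + (evenFact j ℕ.* V (suc d) j) * b′ j k
  collect j = trans (sym (ℤP.*-distribʳ-+ (b′ j k) (+ (suc (2 ℕ.* j) ℕ.* a j)) (+ lower j)))
                    (cong (λ n → n * b′ j k) (trans (sym (ℤP.pos-+ (suc (2 ℕ.* j) ℕ.* a j) (lower j))) (cong +_ (sym (coefficient j)))))

rhsSeq-zero : rhsSeq evenFact 0 ≗ mono 0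
rhsSeq-zero zero    = refl
rhsSeq-zero (suc k) = refl

peakRecurrence-solution : (A : ℕ → Seq) → A 0 ≗ mono 0 → (∀ N → A (suc N) ≗ peakOp N (A N)) →
                          ∀ d → A (2 ℕ.* d) ≗ rhsSeq evenFact d × A (suc (2 ℕ.* d)) ≗ rhsSeq oddFact d
peakRecurrence-solution A A₀ A-suc d = even d , odd d
  where
  odd′ : ∀ d → A (2 ℕ.* d) ≗ rhsSeq evenFact d → A (suc (2 ℕ.* d)) ≗ rhsSeq oddFact d
  odd′ d A≗ k = A-suc (2 ℕ.* d) k ⟨ trans ⟩ peakOp-cong (2 ℕ.* d) A≗ k ⟨ trans ⟩ peakOp-rhsSeq-even d k
  even : ∀ d → A (2 ℕ.* d) ≗ rhsSeq evenFact d
  even zero    k = A₀ k ⟨ trans ⟩ sym (rhsSeq-zero k)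
  even (suc d) k = cong (λ n → A n k) (ℕP.*-suc 2 d) ⟨ trans ⟩ A-suc (suc (2 ℕ.* d)) k
                   ⟨ trans ⟩ peakOp-cong (suc (2 ℕ.* d)) (odd′ d (even d)) k ⟨ trans ⟩ peakOp-rhsSeq-odd d k
  odd : ∀ d → A (suc (2 ℕ.* d)) ≗ rhsSeq oddFact d
  odd d = odd′ d (even d)

eval : ℕ → Seq → ℤ → ℤ
eval zero    p x = 0ℤ
eval (suc B) p x = p 0 + x * eval B (p ∘ suc) x

eval-cong : ∀ B x {p q} → p ≗ q → eval B p x ≡ eval B q x
eval-cong zero    x p≗q = refl
eval-cong (suc B) x p≗q = cong₂ (λ u v → u + x * v) (p≗q 0) (eval-cong B x (p≗q ∘ suc))

eval-⊕ : ∀ B x p q → eval B (p ⊕ q) x ≡ eval B p x + eval B q x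
eval-⊕ zero    x p q = refl
eval-⊕ (suc B) x p q = cong (λ s → (p 0 + q 0) + x * s) (eval-⊕ B x (p ∘ suc) (q ∘ suc))
                       ⟨ trans ⟩ distrib (p 0) (q 0) x (eval B (p ∘ suc) x) (eval B (q ∘ suc) x)
  where
  distrib : ∀ a b x u v → (a + b) + x * (u + v) ≡ (a + x * u) + (b + x * v)
  distrib = solve-∀

eval-⊖ : ∀ B x p q → eval B (p ⊖ q) x ≡ eval B p x - eval B q x
eval-⊖ zero    x p q = refl
eval-⊖ (suc B) x p q = cong (λ s → (p 0 - q 0) + x * s) (eval-⊖ B x (p ∘ suc) (q ∘ suc))
                       ⟨ trans ⟩ distrib (p 0) (q 0) x (eval B (p ∘ suc) x) (eval B (q ∘ suc) x)
  where
  distrib : ∀ a b x u v → (a - b) + x * (u - v) ≡ (a + x * u) - (b + x * v)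
  distrib = solve-∀

eval-⊛ : ∀ B x a p → eval B (a ⊛ p) x ≡ a * eval B p x
eval-⊛ zero    x a p = sym (ℤP.*-zeroʳ a)
eval-⊛ (suc B) x a p = cong (λ s → a * p 0 + x * s) (eval-⊛ B x a (p ∘ suc))
                       ⟨ trans ⟩ distrib a (p 0) x (eval B (p ∘ suc) x)
  where
  distrib : ∀ a y x u → a * y + x * (a * u) ≡ a * (y + x * u)
  distrib = solve-∀

eval-𝟘 : ∀ B x → eval B 𝟘 x ≡ 0ℤ
eval-𝟘 zero    x = refl
eval-𝟘 (suc B) x = cong (λ s → 0ℤ + x * s) (eval-𝟘 B x) ⟨ trans ⟩ trans (ℤP.+-identityˡ _) (ℤP.*-zeroʳ x)

eval-Σ : ∀ B x n F → eval B (Σ⟨ n ⟩ F) x ≡ sumTo n (λ j → eval B (F j) x)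
eval-Σ B x zero    F = eval-𝟘 B x
eval-Σ B x (suc n) F = eval-⊕ B x (F 0) (Σ⟨ n ⟩ (F ∘ suc)) ⟨ trans ⟩ cong (λ s → eval B (F 0) x + s) (eval-Σ B x n (F ∘ suc))

eval-shift : ∀ B x p → eval (suc B) (shift p) x ≡ x * eval B p x
eval-shift B x p = ℤP.+-identityˡ _

eval-mono : ∀ {v B} x → v < B → eval B (mono v) x ≡ x ^ v
eval-mono {zero}  {suc B} x _         = cong (λ s → 1ℤ + x * s) (eval-𝟘 B x) ⟨ trans ⟩ cong (λ s → 1ℤ + s) (ℤP.*-zeroʳ x)
eval-mono {suc v} {suc B} x (s≤s v<B) = eval-shift B x (mono v) ⟨ trans ⟩ cong (x *_) (eval-mono x v<B)

eval-powOneMinusX : ∀ {m B} x → m < B → eval B (powOneMinusX m) x ≡ (1ℤ - x) ^ m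
eval-powOneMinusX {zero}          x m<B       = eval-mono x m<B
eval-powOneMinusX {suc m} {suc B} x (s≤s m<B) = begin
  eval (suc B) (e ⊖ shift e) x                       ≡⟨ eval-⊖ (suc B) x e (shift e) ⟩
  eval (suc B) e x - eval (suc B) (shift e) x        ≡⟨ cong₂ _-_ (eval-powOneMinusX x (ℕP.m<n⇒m<1+n m<B))
                                                              (trans (eval-shift B x e) (cong (x *_) (eval-powOneMinusX x m<B))) ⟩
  (1ℤ - x) ^ m - x * (1ℤ - x) ^ m                    ≡⟨ factor x ((1ℤ - x) ^ m) ⟩
  (1ℤ - x) ^ suc m                                   ∎
  where
  open ≡-Reasoning
  e = powOneMinusX m
  factor : ∀ x y → y - x * y ≡ (1ℤ - x) * y
  factor = solve-∀

eval-bernstein : ∀ j m {B} x → j ℕ.+ m < B → eval B (bernstein j m) x ≡ x ^ j * (1ℤ - x) ^ m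
eval-bernstein zero    m     x lt       = eval-powOneMinusX x lt ⟨ trans ⟩ sym (ℤP.*-identityˡ _)
eval-bernstein (suc j) m {suc B} x (s≤s lt) =
  eval-shift B x (bernstein j m) ⟨ trans ⟩ cong (x *_) (eval-bernstein j m x lt)
  ⟨ trans ⟩ sym (ℤP.*-assoc x (x ^ j) ((1ℤ - x) ^ m))

sumℤ-map-applyUpTo : ∀ n (f : ℕ → ℕ) (g : ℕ → ℤ) → sumℤ (map g (applyUpTo f n)) ≡ sumTo n (g ∘ f)
sumℤ-map-applyUpTo zero    f g = refl
sumℤ-map-applyUpTo (suc n) f g = cong (λ s → g (f 0) + s) (sumℤ-map-applyUpTo n (f ∘ suc) g)

eval-rhsSeq : ∀ c d {B} x → d < B → eval B (rhsSeq c d) x ≡ rhs c d x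
eval-rhsSeq c d {B} x d<B = begin
  eval B (rhsSeq c d) x                                   ≡⟨ eval-Σ B x (suc d) (rhsTerm c d) ⟩
  sumTo (suc d) (λ j → eval B (rhsTerm c d j) x)          ≡⟨ sumTo-cong< (suc d) term ⟩
  sumTo (suc d) (λ j → + (c j ℕ.* V d j) * x ^ j * (1ℤ - x) ^ (d ∸ j))
                                                          ≡⟨ sumℤ-map-applyUpTo (suc d) (λ j → j) (λ j → + (c j ℕ.* V d j) * x ^ j * (1ℤ - x) ^ (d ∸ j)) ⟨
  rhs c d x                                               ∎
  where
  open ≡-Reasoning
  term : ∀ j → j < suc d → eval B (rhsTerm c d j) x ≡ + (c j ℕ.* V d j) * x ^ j * (1ℤ - x) ^ (d ∸ j)
  term j (s≤s j≤d) = eval-⊛ B x (+ (c j ℕ.* V d j)) (bernstein j (d ∸ j))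
    ⟨ trans ⟩ cong (+ (c j ℕ.* V d j) *_) (eval-bernstein j (d ∸ j) x (subst (_< B) (sym (ℕP.m+[n∸m]≡n j≤d)) d<B))
    ⟨ trans ⟩ sym (ℤP.*-assoc (+ (c j ℕ.* V d j)) (x ^ j) ((1ℤ - x) ^ (d ∸ j)))

-- Inserting a new maximum

histogram : List ℕ → Seq
histogram []       = 𝟘
histogram (v ∷ vs) = mono v ⊕ histogram vs

eval-histogram : ∀ {B} x vs → All (_< B) vs → eval B (histogram vs) x ≡ sumℤ (map (x ^_) vs)
eval-histogram {B} x []       []           = eval-𝟘 B x
eval-histogram {B} x (v ∷ vs) (v<B ∷ vs<B) =
  eval-⊕ B x (mono v) (histogram vs) ⟨ trans ⟩ cong₂ _+_ (eval-mono x v<B) (eval-histogram x vs vs<B)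

histogram-++ : ∀ us vs → histogram (us ++ vs) ≗ histogram us ⊕ histogram vs
histogram-++ []       vs k = sym (ℤP.+-identityˡ _)
histogram-++ (u ∷ us) vs k = cong (λ s → mono u k + s) (histogram-++ us vs k) ⟨ trans ⟩ sym (ℤP.+-assoc (mono u k) _ _)

histogram-↭ : ∀ {us vs} → us ↭ vs → histogram us ≗ histogram vs
histogram-↭ ↭-refl         k = refl
histogram-↭ (prep u p)     k = cong (λ s → mono u k + s) (histogram-↭ p k)
histogram-↭ (swap u v p)   k = cong (λ s → mono u k + (mono v k + s)) (histogram-↭ p k)
                             ⟨ trans ⟩ exchange (mono u k) (mono v k) _
  where
  exchange : ∀ a b c → a + (b + c) ≡ b + (a + c)
  exchange = solve-∀
histogram-↭ (↭-trans p q) k = trans (histogram-↭ p k) (histogram-↭ q k)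

histogram-map-suc : ∀ vs → histogram (map suc vs) ≗ shift (histogram vs)
histogram-map-suc []       zero    = refl
histogram-map-suc []       (suc k) = refl
histogram-map-suc (v ∷ vs) k       = cong (λ s → mono (suc v) k + s) (histogram-map-suc vs k) ⟨ trans ⟩ sym (shift-⊕ (mono v) (histogram vs) k)

histogram-map-+ : ∀ g vs → histogram (map (g ℕ.+_) vs) ≗ shiftBy g (histogram vs)
histogram-map-+ zero    vs k = cong (λ ws → histogram ws k) (LP.map-id vs)
histogram-map-+ (suc g) vs k = cong (λ ws → histogram ws k) (LP.map-∘ vs)
                               ⟨ trans ⟩ histogram-map-suc (map (g ℕ.+_) vs) k
                               ⟨ trans ⟩ shift-cong (histogram-map-+ g vs) k

insertions : ℕ → List ℕ → List (List ℕ)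
insertions M []      = (M ∷ []) ∷ []
insertions M (b ∷ r) = (M ∷ b ∷ r) ∷ map (b ∷_) (insertions M r)

peakAt : ℕ → ℕ → List ℕ → ℕ
peakAt a b []      = 0
peakAt a b (c ∷ _) = if (a <ᵇ b) ∧ (c <ᵇ b) then 1 else 0

peaks-∷ : ∀ a b r → peaks (a ∷ b ∷ r) ≡ peakAt a b r ℕ.+ peaks (b ∷ r)
peaks-∷ a b []      = refl
peaks-∷ a b (c ∷ r) = refl

peakAt-bit : ∀ a b r → peakAt a b r ≡ 0 ⊎ peakAt a b r ≡ 1
peakAt-bit a b []      = inj₁ refl
peakAt-bit a b (c ∷ r) with (a <ᵇ b) ∧ (c <ᵇ b)
... | true  = inj₂ refl
... | false = inj₁ refl

peakAt-≤1 : ∀ a b r → peakAt a b r ≤ 1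
peakAt-≤1 a b r with peakAt-bit a b r
... | inj₁ β≡0 = subst (_≤ 1) (sym β≡0) z≤n
... | inj₂ β≡1 = ℕP.≤-reflexive β≡1

<ᵇ-false : ∀ {m n} → n ≤ m → (m <ᵇ n) ≡ false
<ᵇ-false {m} {n} n≤m with m <ᵇ n in m<ᵇn
... | false = refl
... | true  = contradiction (ℕP.<ᵇ⇒< m n (subst T (sym m<ᵇn) _)) (ℕP.≤⇒≯ n≤m)

<ᵇ-true : ∀ {m n} → m < n → (m <ᵇ n) ≡ true
<ᵇ-true m<n = Equivalence.to BoolP.T-≡ (ℕP.<⇒<ᵇ m<n)

peakAt-≤ : ∀ {a b} r → b ≤ a → peakAt a b r ≡ 0
peakAt-≤ []      b≤a = refl
peakAt-≤ (c ∷ r) b≤a rewrite <ᵇ-false b≤a = refl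

peakAt-below : ∀ a {b c} r → b < c → peakAt a b (c ∷ r) ≡ 0
peakAt-below a {b} r b<c rewrite <ᵇ-false (ℕP.<⇒≤ b<c) | BoolP.∧-zeroʳ (a <ᵇ b) = refl

peakAt-peak : ∀ {a b c} r → a < b → c < b → peakAt a b (c ∷ r) ≡ 1
peakAt-peak r a<b c<b rewrite <ᵇ-true a<b | <ᵇ-true c<b = refl

peaks-new-max : ∀ a {b c M} r → b < M → c < M → peaks (a ∷ b ∷ M ∷ c ∷ r) ≡ suc (peaks (c ∷ r))
peaks-new-max a {b} {c} {M} r b<M c<M =
  cong₂ (λ u v → u ℕ.+ (v ℕ.+ peaks (M ∷ c ∷ r))) (peakAt-below a (c ∷ r) b<M) (peakAt-peak r b<M c<M)
  ⟨ trans ⟩ cong suc (peaks-∷ M c r ⟨ trans ⟩ cong (ℕ._+ peaks (c ∷ r)) (peakAt-≤ r (ℕP.<⇒≤ c<M)))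

peaks-≤ : ∀ a w → peaks (a ∷ w) ≤ length w
peaks-≤ a []          = z≤n
peaks-≤ a (b ∷ [])    = z≤n
peaks-≤ a (b ∷ c ∷ w) = ℕP.+-mono-≤ (peakAt-≤1 a b (c ∷ w)) (peaks-≤ b (c ∷ w))

-- The peak counts after inserting a new maximum into each of the ℓ + 1 slots behind the
-- second letter of a word with t peaks; β ∈ {0, 1} says whether that second letter is a peak.
profile : ℕ → ℕ → ℕ → Seq
profile t β ℓ = (+ 2 * + t + 1ℤ - + β) ⊛ mono t ⊕ (+ ℓ - + 2 * + t + + β) ⊛ mono (suc t)

profile-extend : ∀ p t₀ β ℓ → β ≡ 0 ⊎ β ≡ 1 → (T p → β ≡ 0) →
                 mono (suc t₀) ⊕ shiftBy (if p then 1 else 0) (profile (β ℕ.+ t₀) β ℓ)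
                 ≗ profile ((if p then 1 else 0) ℕ.+ (β ℕ.+ t₀)) (if p then 1 else 0) (suc ℓ)
profile-extend false t₀ .0 ℓ (inj₁ refl) _ k =
  absorb (mono t₀ k) (mono (suc t₀) k) (+ t₀) (+ ℓ)
  where
  absorb : ∀ A B y l → B + ((+ 2 * y + 1ℤ - 0ℤ) * A + (l - + 2 * y + 0ℤ) * B)
                       ≡ (+ 2 * y + 1ℤ - 0ℤ) * A + ((1ℤ + l) - + 2 * y + 0ℤ) * B
  absorb = solve-∀
profile-extend false t₀ .1 ℓ (inj₂ refl) _ k =
  absorb (mono (suc t₀) k) (mono (suc (suc t₀)) k) (+ t₀) (+ ℓ)
  where
  absorb : ∀ B C y l → B + ((+ 2 * (1ℤ + y) + 1ℤ - 1ℤ) * B + (l - + 2 * (1ℤ + y) + 1ℤ) * C)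
                       ≡ (+ 2 * (1ℤ + y) + 1ℤ - 0ℤ) * B + ((1ℤ + l) - + 2 * (1ℤ + y) + 0ℤ) * C
  absorb = solve-∀
profile-extend true  t₀ β  ℓ _ β≡0 k with β≡0 _
profile-extend true  t₀ .0 ℓ _ _ zero    | refl =
  absorb (+ 2 * + suc t₀ + 1ℤ - 1ℤ) (+ suc ℓ - + 2 * + suc t₀ + 1ℤ)
  where
  absorb : ∀ α β → 0ℤ + 0ℤ ≡ α * 0ℤ + β * 0ℤ
  absorb = solve-∀
profile-extend true  t₀ .0 ℓ _ _ (suc k) | refl =
  absorb (mono t₀ k) (mono (suc t₀) k) (+ t₀) (+ ℓ)
  where
  absorb : ∀ A B y l → A + ((+ 2 * y + 1ℤ - 0ℤ) * A + (l - + 2 * y + 0ℤ) * B)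
                       ≡ (+ 2 * (1ℤ + y) + 1ℤ - 1ℤ) * A + ((1ℤ + l) - + 2 * (1ℤ + y) + 1ℤ) * B
  absorb = solve-∀

histogram-insertions : ∀ {M} a b r → b < M → All (_< M) r →
                       histogram (map (λ w → peaks (a ∷ b ∷ w)) (insertions M r))
                       ≗ profile (peaks (a ∷ b ∷ r)) (peakAt a b r) (length r)
histogram-insertions {M} a b []      b<M []          k =
  cong (λ n → mono (n ℕ.+ 0) k + 0ℤ) (peakAt-below a [] b<M) ⟨ trans ⟩ unit (mono 0 k) (mono 1 k)
  where
  unit : ∀ A B → A + 0ℤ ≡ (+ 2 * 0ℤ + 1ℤ - 0ℤ) * A + (0ℤ - + 2 * 0ℤ + 0ℤ) * B
  unit = solve-∀
histogram-insertions {M} a b (c ∷ r) b<M (c<M ∷ r<M) k = begin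
  mono (peaks (a ∷ b ∷ M ∷ c ∷ r)) k + histogram (map (λ w → peaks (a ∷ b ∷ w)) (map (c ∷_) X)) k
    ≡⟨ cong₂ (λ t ws → mono t k + histogram ws k) (peaks-new-max a r b<M c<M) (trans (sym (LP.map-∘ X)) (LP.map-∘ X)) ⟩
  mono (suc t₀) k + histogram (map (g ℕ.+_) Y) k
    ≡⟨ cong (λ s → mono (suc t₀) k + s) (histogram-map-+ g Y k ⟨ trans ⟩ shiftBy-cong g IH k) ⟩
  mono (suc t₀) k + shiftBy g (profile (β ℕ.+ t₀) β (length r)) k
    ≡⟨ profile-extend p t₀ β (length r) (peakAt-bit b c r) no-double-peak k ⟩
  profile (g ℕ.+ (β ℕ.+ t₀)) g (suc (length r)) k
    ≡⟨ cong (λ t → profile (g ℕ.+ t) g (suc (length r)) k) (peaks-∷ b c r) ⟨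
  profile (peaks (a ∷ b ∷ c ∷ r)) g (length (c ∷ r)) k ∎
  where
  open ≡-Reasoning
  X = insertions M r
  Y = map (λ w → peaks (b ∷ c ∷ w)) X
  p = (a <ᵇ b) ∧ (c <ᵇ b)
  g = if p then 1 else 0
  β = peakAt b c r
  t₀ = peaks (c ∷ r)
  IH : histogram Y ≗ profile (β ℕ.+ t₀) β (length r)
  IH k = histogram-insertions b c r c<M r<M k ⟨ trans ⟩ cong (λ t → profile t β (length r) k) (peaks-∷ b c r)
  no-double-peak : T p → β ≡ 0
  no-double-peak a<b>c = peakAt-≤ r (ℕP.<⇒≤ (ℕP.<ᵇ⇒< c b (proj₂ (Equivalence.to BoolP.T-∧ a<b>c))))

mono-* : ∀ t k (f : ℕ → ℤ) → f k * mono t k ≡ f t * mono t k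
mono-* zero    zero    f = refl
mono-* zero    (suc k) f = trans (ℤP.*-zeroʳ (f (suc k))) (sym (ℤP.*-zeroʳ (f 0)))
mono-* (suc t) zero    f = trans (ℤP.*-zeroʳ (f 0)) (sym (ℤP.*-zeroʳ (f (suc t))))
mono-* (suc t) (suc k) f = mono-* t k (f ∘ suc)

peakOp-mono : ∀ N t → peakOp N (mono t) ≗ profile t 0 N
peakOp-mono N t k =
  cong₂ _+_ (mono-* t k (λ i → + 2 * + i + 1ℤ)) (mono-* (suc t) k (λ i → + N + + 2 - + 2 * + i))
  ⟨ trans ⟩ regroup (mono t k) (mono (suc t) k) (+ t) (+ N)
  where
  regroup : ∀ A B y n → (+ 2 * y + 1ℤ) * A + (n + + 2 - + 2 * (1ℤ + y)) * B
                        ≡ (+ 2 * y + 1ℤ - 0ℤ) * A + (n - + 2 * y + 0ℤ) * B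
  regroup = solve-∀

-- The extra 0 lets histogram-insertions, which inserts behind the second letter, reach every
-- slot; it adds no peak since 0 < 0 fails.
lpk-peaks : ∀ π → lpk π ≡ peaks (0 ∷ 0 ∷ π)
lpk-peaks []      = refl
lpk-peaks (c ∷ π) = refl

histogram-lpk-insertions : ∀ N π → All (_< suc N) π → length π ≡ N →
                           histogram (map lpk (insertions (suc N) π)) ≗ peakOp N (mono (lpk π))
histogram-lpk-insertions N π π<M |π|≡N k = begin
  histogram (map lpk (insertions (suc N) π)) k
    ≡⟨ cong (λ ws → histogram ws k) (LP.map-cong lpk-peaks (insertions (suc N) π)) ⟩
  histogram (map (λ w → peaks (0 ∷ 0 ∷ w)) (insertions (suc N) π)) k
    ≡⟨ histogram-insertions 0 0 π (s≤s z≤n) π<M k ⟩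
  profile (peaks (0 ∷ 0 ∷ π)) (peakAt 0 0 π) (length π) k
    ≡⟨ cong₂ (λ t β → profile t β (length π) k) (lpk-peaks π) (sym (peakAt-≤ {0} {0} π z≤n)) ⟨
  profile (lpk π) 0 (length π) k
    ≡⟨ cong (λ ℓ → profile (lpk π) 0 ℓ k) |π|≡N ⟩
  profile (lpk π) 0 N k
    ≡⟨ peakOp-mono N (lpk π) k ⟨
  peakOp N (mono (lpk π)) k ∎
  where open ≡-Reasoning

-- Permutations

InRange : ℕ → ℕ → Set
InRange n a = 1 ≤ a × a ≤ n

IsPerm : ℕ → List ℕ → Set
IsPerm n w = length w ≡ n × All (InRange n) w × Unique w

any-≡ᵇ⇔∈ : ∀ a w → T (any (a ≡ᵇ_) w) ⇔ a ∈ w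
any-≡ᵇ⇔∈ a w = mk⇔ (Any.map (ℕP.≡ᵇ⇒≡ a _) ∘ AnyP.any⁻ (a ≡ᵇ_) w)
                   (AnyP.any⁺ (a ≡ᵇ_) ∘ Any.map (λ { refl → ℕP.≡⇒≡ᵇ a a refl }))

distinct⇒Unique : ∀ w → T (distinct w) → Unique w
distinct⇒Unique []      _ = []
distinct⇒Unique (a ∷ w) d with Equivalence.to BoolP.T-∧ d
... | a∉w , w-distinct =
  ¬Any⇒All¬ w (λ a∈w → subst T (Equivalence.to BoolP.T-not-≡ a∉w) (Equivalence.from (any-≡ᵇ⇔∈ a w) a∈w))
  ∷ distinct⇒Unique w w-distinct

Unique⇒distinct : ∀ w → Unique w → T (distinct w)
Unique⇒distinct []      _            = _
Unique⇒distinct (a ∷ w) (a∉w ∷ uniq) = Equivalence.from BoolP.T-∧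
  ( Equivalence.from BoolP.T-not-≡ (BoolP.¬-not (All¬⇒¬Any a∉w ∘ Equivalence.to (any-≡ᵇ⇔∈ a w) ∘ Equivalence.from BoolP.T-≡))
  , Unique⇒distinct w uniq )

Unique-concatMap⁺ : ∀ {A B : Set} {f : A → List B} (key : B → A) {xs} → Unique xs →
                    (∀ {x} → x ∈ xs → Unique (f x)) → (∀ {x y} → x ∈ xs → y ∈ f x → key y ≡ x) →
                    Unique (concatMap f xs)
Unique-concatMap⁺ key {[]}     _            _      _       = []
Unique-concatMap⁺ key {x ∷ xs} (x∉xs ∷ uniq) f-uniq key-inv =
  UniqueP.++⁺ (f-uniq (here refl))
              (Unique-concatMap⁺ key uniq (f-uniq ∘ there) (key-inv ∘ there))
              disjoint
  where
  disjoint : ∀ {v} → ¬ (v ∈ _ × v ∈ concatMap _ xs)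
  disjoint (v∈fx , v∈rest) with find (∈-concatMap⁻ _ v∈rest)
  ... | x′ , x′∈xs , v∈fx′ = All¬⇒¬Any x∉xs (subst (_∈ xs) (sym (key-inv (there x′∈xs) v∈fx′) ⟨ trans ⟩ key-inv (here refl) v∈fx) x′∈xs)

∈-letters⁻ : ∀ n {a} → a ∈ map suc (upTo n) → InRange n a
∈-letters⁻ n a∈ with ∈-map⁻ suc a∈
... | i , i∈ , refl = s≤s z≤n , ∈-upTo⁻ i∈

∈-letters⁺ : ∀ n {a} → InRange n a → a ∈ map suc (upTo n)
∈-letters⁺ n {suc i} (_ , i<n) = ∈-map⁺ suc (∈-upTo⁺ i<n)

∈-words⁻ : ∀ n k {w} → w ∈ words n k → length w ≡ k × All (InRange n) w
∈-words⁻ n zero    (here refl) = refl , []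
∈-words⁻ n (suc k) w∈ with find (∈-concatMap⁻ (λ a → map (a ∷_) (words n k)) {map suc (upTo n)} w∈)
... | a , a∈ , w∈′ with ∈-map⁻ (a ∷_) w∈′
... | w′ , w′∈ , refl with ∈-words⁻ n k w′∈
... | |w′|≡k , w′-range = cong suc |w′|≡k , ∈-letters⁻ n a∈ ∷ w′-range

∈-words⁺ : ∀ n k {w} → length w ≡ k → All (InRange n) w → w ∈ words n k
∈-words⁺ n zero    {[]}    refl []              = here refl
∈-words⁺ n (suc k) {a ∷ w} |w|≡k (a-range ∷ w-range) =
  ∈-concatMap⁺ (λ a → map (a ∷_) (words n k)) (lose (∈-letters⁺ n a-range) (∈-map⁺ (a ∷_) (∈-words⁺ n k (ℕP.suc-injective |w|≡k) w-range)))

head : List ℕ → ℕ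
head []      = 0
head (a ∷ _) = a

words-Unique : ∀ n k → Unique (words n k)
words-Unique n zero    = [] ∷ []
words-Unique n (suc k) = Unique-concatMap⁺ head (UniqueP.map⁺ ℕP.suc-injective (UniqueP.upTo⁺ n))
  (λ _ → UniqueP.map⁺ LP.∷-injectiveʳ (words-Unique n k))
  (λ _ → head-of)
  where
  head-of : ∀ {a w} → w ∈ map (a ∷_) (words n k) → head w ≡ a
  head-of w∈ with ∈-map⁻ _ w∈
  ... | _ , _ , refl = refl

∈-perms⁻ : ∀ n {w} → w ∈ perms n → IsPerm n w
∈-perms⁻ n w∈ with ∈-filter⁻ (T? ∘ distinct) w∈
... | w∈words , w-distinct with ∈-words⁻ n n w∈words
... | |w|≡n , w-range = |w|≡n , w-range , distinct⇒Unique _ w-distinct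

∈-perms⁺ : ∀ n {w} → IsPerm n w → w ∈ perms n
∈-perms⁺ n {w} (|w|≡n , w-range , uniq) = ∈-filter⁺ (T? ∘ distinct) (∈-words⁺ n n |w|≡n w-range) (Unique⇒distinct w uniq)

perms-Unique : ∀ n → Unique (perms n)
perms-Unique n = UniqueP.filter⁺ (T? ∘ distinct) (words-Unique n n)

delete : ℕ → List ℕ → List ℕ
delete M = filter (λ a → ¬? (a ≟ M))

delete-∉ : ∀ {M w} → M ∉ w → delete M w ≡ w
delete-∉ {M} {w} M∉w = LP.filter-all (λ a → ¬? (a ≟ M)) (All.map (λ M≢a → M≢a ∘ sym) (¬Any⇒All¬ w M∉w))

delete-head : ∀ M w → delete M (M ∷ w) ≡ delete M w
delete-head M w = LP.filter-reject (λ a → ¬? (a ≟ M)) (λ M≢M → M≢M refl)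

delete-∷ : ∀ {M a} w → a ≢ M → delete M (a ∷ w) ≡ a ∷ delete M w
delete-∷ w a≢M = LP.filter-accept (λ a → ¬? (a ≟ _)) a≢M

delete-Unique : ∀ M {w} → Unique w → Unique (delete M w)
delete-Unique M = UniqueP.filter⁺ (λ a → ¬? (a ≟ M))

delete-InRange : ∀ {n w} → All (InRange (suc n)) w → All (InRange n) (delete (suc n) w)
delete-InRange {n} range = All.tabulate λ a∈ →
  let a∈w , a≢M = ∈-filter⁻ (λ a → ¬? (a ≟ suc n)) a∈
      1≤a , a≤M = All.lookup range a∈w
  in 1≤a , ℕP.≤-pred (ℕP.≤∧≢⇒< a≤M a≢M)

insertions-head : ∀ M w → (M ∷ w) ∈ insertions M w
insertions-head M []      = here refl
insertions-head M (b ∷ r) = here refl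

insertions-↭ : ∀ M π {w} → w ∈ insertions M π → w ↭ M ∷ π
insertions-↭ M []      (here refl) = ↭-refl
insertions-↭ M (b ∷ r) (here refl) = ↭-refl
insertions-↭ M (b ∷ r) (there w∈) with ∈-map⁻ (b ∷_) w∈
... | w′ , w′∈ , refl = ↭-trans (prep b (insertions-↭ M r w′∈)) (swap b M ↭-refl)

delete-insertions : ∀ {M π w} → M ∉ π → w ∈ insertions M π → delete M w ≡ π
delete-insertions {M} {[]}    M∉π (here refl) = delete-head M []
delete-insertions {M} {b ∷ r} M∉π (here refl) = delete-head M (b ∷ r) ⟨ trans ⟩ delete-∉ M∉π
delete-insertions {M} {b ∷ r} M∉π (there w∈) with ∈-map⁻ (b ∷_) w∈
... | w′ , w′∈ , refl = delete-∷ w′ (λ b≡M → M∉π (here (sym b≡M))) ⟨ trans ⟩ cong (b ∷_) (delete-insertions (M∉π ∘ there) w′∈)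

insertions-delete : ∀ {M w} → Unique w → M ∈ w → w ∈ insertions M (delete M w)
insertions-delete {M} {a ∷ w} (a∉w ∷ uniq) M∈ with a ≟ M
... | yes refl = subst (λ v → (a ∷ w) ∈ insertions a v) (sym (delete-head a w ⟨ trans ⟩ delete-∉ (All¬⇒¬Any a∉w)))
                       (insertions-head a w)
... | no a≢M with M∈
...   | here M≡a = contradiction (sym M≡a) a≢M
...   | there M∈w = subst (λ v → (a ∷ w) ∈ insertions M v) (sym (delete-∷ w a≢M))
                          (there (∈-map⁺ (a ∷_) (insertions-delete uniq M∈w)))

insertions-Unique : ∀ {M} π → M ∉ π → Unique (insertions M π)
insertions-Unique []      M∉π = [] ∷ []
insertions-Unique (b ∷ r) M∉π =
  All.tabulate head-new ∷ UniqueP.map⁺ LP.∷-injectiveʳ (insertions-Unique r (M∉π ∘ there))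
  where
  head-new : ∀ {w} → w ∈ map (b ∷_) (insertions _ r) → _ ≢ w
  head-new w∈ with ∈-map⁻ (b ∷_) w∈
  ... | _ , _ , refl = M∉π ∘ here ∘ LP.∷-injectiveˡ

length-delete : ∀ {M w} → Unique w → M ∈ w → length w ≡ suc (length (delete M w))
length-delete uniq M∈w = ↭-length (insertions-↭ _ _ (insertions-delete uniq M∈w))

Unique-InRange-length : ∀ n {w} → Unique w → All (InRange n) w → length w ≤ n
Unique-InRange-length zero    {[]}    _    _                  = z≤n
Unique-InRange-length zero    {a ∷ w} _    ((1≤a , a≤0) ∷ _)  = contradiction (ℕP.≤-trans 1≤a a≤0) λ ()
Unique-InRange-length (suc n) {w}     uniq range with suc n ∈? w
... | yes M∈w = ℕP.≤-reflexive (length-delete uniq M∈w) ⟨ ℕP.≤-trans ⟩ s≤s rest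
  where rest = Unique-InRange-length n (delete-Unique (suc n) uniq) (delete-InRange range)
... | no  M∉w = subst (λ v → length v ≤ suc n) (delete-∉ M∉w)
                      (ℕP.m≤n⇒m≤1+n (Unique-InRange-length n (delete-Unique (suc n) uniq) (delete-InRange range)))

max∉ : ∀ {N π} → All (InRange N) π → suc N ∉ π
max∉ range M∈π = ℕP.1+n≰n (proj₂ (All.lookup range M∈π))

max∈ : ∀ {N w} → IsPerm (suc N) w → suc N ∈ w
max∈ {N} {w} (|w|≡ , range , uniq) with suc N ∈? w
... | yes M∈w = M∈w
... | no  M∉w = contradiction (subst (_≤ N) |w|≡ (Unique-InRange-length N uniq (subst (All (InRange N)) (delete-∉ M∉w) (delete-InRange range))))
                              ℕP.1+n≰n

insertions-IsPerm : ∀ {N π w} → IsPerm N π → w ∈ insertions (suc N) π → IsPerm (suc N) w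
insertions-IsPerm {N} {π} (|π|≡N , range , uniq) w∈ =
    (↭-length w↭ ⟨ trans ⟩ cong suc |π|≡N)
  , All-resp-↭ (↭-sym w↭) ((s≤s z≤n , ℕP.≤-refl) ∷ All.map (λ (1≤a , a≤N) → 1≤a , ℕP.m≤n⇒m≤1+n a≤N) range)
  , PermₛP.Unique-resp-↭ (setoid ℕ) (↭⇒↭ₛ (↭-sym w↭)) (¬Any⇒All¬ π (max∉ range) ∷ uniq)
  where w↭ = insertions-↭ (suc N) π w∈

delete-IsPerm : ∀ {N w} → IsPerm (suc N) w → IsPerm N (delete (suc N) w)
delete-IsPerm P@(|w|≡ , range , uniq) =
  ℕP.suc-injective (sym (length-delete uniq (max∈ P)) ⟨ trans ⟩ |w|≡) , delete-InRange range , delete-Unique _ uniq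

perms-suc-↭ : ∀ N → perms (suc N) ↭ concatMap (insertions (suc N)) (perms N)
perms-suc-↭ N = ∼bag⇒↭ (unique∧set⇒bag (perms-Unique (suc N)) concat-Unique (mk⇔ to from))
  where
  concat-Unique : Unique (concatMap (insertions (suc N)) (perms N))
  concat-Unique = Unique-concatMap⁺ (delete (suc N)) (perms-Unique N)
    (λ π∈ → insertions-Unique _ (max∉ (proj₁ (proj₂ (∈-perms⁻ N π∈)))))
    (λ π∈ → delete-insertions (max∉ (proj₁ (proj₂ (∈-perms⁻ N π∈)))))
  to : ∀ {w} → w ∈ perms (suc N) → w ∈ concatMap (insertions (suc N)) (perms N)
  to w∈ = let P = ∈-perms⁻ (suc N) w∈ in
    ∈-concatMap⁺ (insertions (suc N)) (lose (∈-perms⁺ N (delete-IsPerm P)) (insertions-delete (proj₂ (proj₂ P)) (max∈ P)))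
  from : ∀ {w} → w ∈ concatMap (insertions (suc N)) (perms N) → w ∈ perms (suc N)
  from w∈ with find (∈-concatMap⁻ (insertions (suc N)) {perms N} w∈)
  ... | π , π∈ , w∈π = ∈-perms⁺ (suc N) (insertions-IsPerm (∈-perms⁻ N π∈) w∈π)

lpkHistogram : ℕ → Seq
lpkHistogram N = histogram (map lpk (perms N))

lpkHistogram-zero : lpkHistogram 0 ≗ mono 0
lpkHistogram-zero zero    = refl
lpkHistogram-zero (suc k) = refl

histogram-lpk-concatMap : ∀ N πs → All (IsPerm N) πs →
                          histogram (map lpk (concatMap (insertions (suc N)) πs)) ≗ peakOp N (histogram (map lpk πs))
histogram-lpk-concatMap N []       []                k = sym (peakOp-𝟘 N k)
histogram-lpk-concatMap N (π ∷ πs) ((|π|≡N , range , _) ∷ Ps) k = begin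
  histogram (map lpk (insertions (suc N) π ++ rest)) k
    ≡⟨ cong (λ ws → histogram ws k) (LP.map-++ lpk (insertions (suc N) π) rest) ⟩
  histogram (map lpk (insertions (suc N) π) ++ map lpk rest) k
    ≡⟨ histogram-++ (map lpk (insertions (suc N) π)) (map lpk rest) k ⟩
  histogram (map lpk (insertions (suc N) π)) k + histogram (map lpk rest) k
    ≡⟨ cong₂ _+_ (histogram-lpk-insertions N π (All.map (s≤s ∘ proj₂) range) |π|≡N k) (histogram-lpk-concatMap N πs Ps k) ⟩
  peakOp N (mono (lpk π)) k + peakOp N (histogram (map lpk πs)) k
    ≡⟨ peakOp-⊕ N (mono (lpk π)) (histogram (map lpk πs)) k ⟨
  peakOp N (histogram (map lpk (π ∷ πs))) k ∎
  where
  open ≡-Reasoning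
  rest = concatMap (insertions (suc N)) πs

lpkHistogram-suc : ∀ N → lpkHistogram (suc N) ≗ peakOp N (lpkHistogram N)
lpkHistogram-suc N k =
  histogram-↭ (PermP.map⁺ lpk (perms-suc-↭ N)) k
  ⟨ trans ⟩ histogram-lpk-concatMap N (perms N) (All.tabulate (∈-perms⁻ N)) k

leftPeakPoly-eval : ∀ N x → leftPeakPoly N x ≡ eval (suc N) (lpkHistogram N) x
leftPeakPoly-eval N x =
  cong sumℤ (LP.map-∘ (perms N)) ⟨ trans ⟩ sym (eval-histogram x (map lpk (perms N)) (AllP.map⁺ (All.tabulate lpk<)))
  where
  lpk< : ∀ {π} → π ∈ perms N → lpk π < suc N
  lpk< {π} π∈ = s≤s (subst (lpk π ≤_) (proj₁ (∈-perms⁻ N π∈)) (peaks-≤ 0 π))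

theorem4 : (n : ℕ) → n ℕ.≥ 1 → (x : ℤ) →
    (leftPeakPoly (2 ℕ.* n) x ≡ rhs (λ j → (2 ℕ.* j) !) n x)
    × (leftPeakPoly (suc (2 ℕ.* n)) x ≡ rhs (λ j → (suc (2 ℕ.* j)) !) n x)
theorem4 n _ x =
  let even , odd = peakRecurrence-solution lpkHistogram lpkHistogram-zero lpkHistogram-suc n in
    (leftPeakPoly-eval (2 ℕ.* n) x ⟨ trans ⟩ eval-cong (suc (2 ℕ.* n)) x even ⟨ trans ⟩ eval-rhsSeq evenFact n x n<2n+1)
  , (leftPeakPoly-eval (suc (2 ℕ.* n)) x ⟨ trans ⟩ eval-cong (2 ℕ.+ 2 ℕ.* n) x odd
       ⟨ trans ⟩ eval-rhsSeq oddFact n x (ℕP.m<n⇒m<1+n n<2n+1))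
  where
  n<2n+1 : n < suc (2 ℕ.* n)
  n<2n+1 = s≤s (ℕP.m≤m+n n (n ℕ.+ 0))
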